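{- For every small $P$-algebra $C$, the type $\mathsf{isind}(C)$ is a mere proposition.
   Context: Work in the intensional Martin-Löf type theory $\mathcal{H}$ with $\Sigma$-types, $\Pi$-types (with judgemental $\eta$), identity types, a universe $\mathsf{U}$ closed under $\Sigma,\Pi,\mathsf{Id}$, and function extensionality; no UIP. A type $X$ is a mere proposition if for all $x,y:X$ the type $\mathsf{Id}_X(x,y)$ is contractible (contractible: $(\Sigma z:Z)(\Pi w:Z)\mathsf{Id}(z,w)$ inhabited). Fix $A:\mathsf{U}$, $B:A\to\mathsf{U}$; $PC:=(\Sigma x:A)(B(x)\to C)$. A small $P$-algebra is $(C,\sup_C)$ with $C:\mathsf{U}$, $\sup_C:PC\to C$. $\mathsf{FibAlg}(C):=(\Sigma E:C\to\mathsf{U})(\Pi x:A)(\Pi u:B(x)\to C)((\Pi y:B(x))E(uy))\to E(\sup_C(x,u))$. For $(E,e)$ in it, $\mathsf{AlgSec}(C,E):=(\Sigma f:(\Pi z:C)E(z))(\Pi x:A)(\Pi u:B(x)\to C)\mathsf{Id}(f(\sup_C(x,u)),e(x,u,\lambda y.f(uy)))$. $\mathsf{isind}(C):=(\Pi E:\mathsf{FibAlg}(C))\mathsf{AlgSec}(C,E)$. -}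

{-# OPTIONS --without-K #-}
module Defs where

open import Level using (Level; Setω)
open import Data.Product using (Σ; Σ-syntax; _,_)
open import Relation.Binary.PropositionalEquality using (_≡_)

-- The universe U of the paper is Agda's Set (= Set₀).

isContr : ∀ {ℓ} → Set ℓ → Set ℓ
isContr Z = Σ[ z ∈ Z ] ((w : Z) → z ≡ w)

isProp : ∀ {ℓ} → Set ℓ → Set ℓ
isProp X = (x y : X) → isContr (x ≡ y)

-- Function extensionality (an axiom of the ambient theory H), as in
-- Axiom.Extensionality.Propositional, for all universe levels.
FunExt : Setω
FunExt = ∀ {a b : Level} {X : Set a} {Y : X → Set b} {f g : (x : X) → Y x}
         → ((x : X) → f x ≡ g x) → f ≡ g

module _ (A : Set) (B : A → Set) where

  P : Set → Set
  P C = Σ[ x ∈ A ] (B x → C)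

  FibAlg : (C : Set) → (P C → C) → Set₁
  FibAlg C supC =
    Σ[ E ∈ (C → Set) ]
      ((x : A) (u : B x → C) → ((y : B x) → E (u y)) → E (supC (x , u)))

  AlgSec : (C : Set) (supC : P C → C) → FibAlg C supC → Set
  AlgSec C supC (E , e) =
    Σ[ f ∈ ((z : C) → E z) ]
      ((x : A) (u : B x → C) → f (supC (x , u)) ≡ e x u (λ y → f (u y)))

  isind : (C : Set) → (P C → C) → Set₁
  isind C supC = (E : FibAlg C supC) → AlgSec C supC E

{-# OPTIONS --without-K #-}
module Submission where

-- If C is inductive, every fibered algebra E over C has an algebra section, and any two
-- sections s, t are equal: the pointwise paths between s and t form a fibered algebra
-- (using function extensionality), and a section of it yields s ≡ t by induction on
-- homotopies. So isind C is a product of contractible types as soon as it is inhabited,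
-- hence a proposition.

open import Defs
open import Level using (_⊔_)
open import Data.Product using (Σ; Σ-syntax; _,_; proj₁; proj₂)
open import Relation.Binary.PropositionalEquality using (_≡_; refl; sym; trans; cong; subst)
open import Relation.Binary.PropositionalEquality.Properties using (trans-reflʳ; trans-symˡ)

module _ {ℓ} {X : Set ℓ} where

  isContr⇒isProp : isContr X → isProp X
  isContr⇒isProp (c , h) x y = trans (sym (h x)) (h y) , contraction
    where
    contraction : ∀ {y} (r : x ≡ y) → trans (sym (h x)) (h y) ≡ r
    contraction refl = trans-symˡ (h x)

  inhabited⇒isContr⇒isProp : (X → isContr X) → isProp X
  inhabited⇒isContr⇒isProp h x = isContr⇒isProp (h x) x

  singleton-isContr : (x : X) → isContr (Σ[ y ∈ X ] (x ≡ y))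
  singleton-isContr x = (x , refl) , λ { (y , refl) → refl }

  ≡-from-refl≡trans-sym : {x y : X} (p q : x ≡ y) → refl ≡ trans p (sym q) → p ≡ q
  ≡-from-refl≡trans-sym p refl e = sym (trans e (trans-reflʳ p))

module _ (fe : FunExt) where

  Π-isContr : ∀ {a b} {X : Set a} {Y : X → Set b}
            → ((x : X) → isContr (Y x)) → isContr ((x : X) → Y x)
  Π-isContr c = (λ x → proj₁ (c x)) , λ g → fe (λ x → proj₂ (c x) (g x))

  module _ {a b} {X : Set a} {Y : X → Set b} where

    Homotopies : ((x : X) → Y x) → Set (a ⊔ b)
    Homotopies f = Σ[ g ∈ ((x : X) → Y x) ] ((x : X) → f x ≡ g x)

    -- A retract of the contractible type of pointwise singletons, with retraction
    -- holding judgementally by η.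
    Homotopies-isContr : (f : (x : X) → Y x) → isContr (Homotopies f)
    Homotopies-isContr f = toHomotopy c , λ t → cong toHomotopy (h (fromHomotopy t))
      where
      c = proj₁ (Π-isContr (λ x → singleton-isContr (f x)))
      h = proj₂ (Π-isContr (λ x → singleton-isContr (f x)))
      toHomotopy : ((x : X) → Σ[ z ∈ Y x ] (f x ≡ z)) → Homotopies f
      toHomotopy s = (λ x → proj₁ (s x)) , (λ x → proj₂ (s x))
      fromHomotopy : Homotopies f → (x : X) → Σ[ z ∈ Y x ] (f x ≡ z)
      fromHomotopy (g , k) x = g x , k x

    homotopy-ind : ∀ {ℓ} (f : (x : X) → Y x)
                   (Q : (g : (x : X) → Y x) → ((x : X) → f x ≡ g x) → Set ℓ)
                 → Q f (λ _ → refl) → (g : (x : X) → Y x) (k : (x : X) → f x ≡ g x) → Q g k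
    homotopy-ind f Q q g k = subst (λ t → Q (proj₁ t) (proj₂ t)) centre-path q
      where
      centre-path = proj₁ (isContr⇒isProp (Homotopies-isContr f) (f , λ _ → refl) (g , k))

    -- fe need not send the trivial homotopy to refl; composing with the inverse of
    -- that value gives a variant that does.
    funext : {f g : (x : X) → Y x} → ((x : X) → f x ≡ g x) → f ≡ g
    funext {f} h = trans (sym (fe {f = f} {g = f} (λ _ → refl))) (fe h)

    funext-refl : (f : (x : X) → Y x) → funext {f} (λ _ → refl) ≡ refl
    funext-refl f = trans-symˡ (fe {f = f} {g = f} (λ _ → refl))

  module _ {A : Set} {B : A → Set} {C : Set} {supC : P A B C → C} where

    PathFibAlg : (E : FibAlg A B C supC) (s t : AlgSec A B C supC E) → FibAlg A B C supC
    PathFibAlg (E , e) (f , p) (g , q) =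
      (λ z → f z ≡ g z) ,
      λ x u h → trans (p x u) (trans (cong (e x u) (funext h)) (sym (q x u)))

    AlgSec-path : (E : FibAlg A B C supC) (s t : AlgSec A B C supC E)
                → AlgSec A B C supC (PathFibAlg E s t) → s ≡ t
    AlgSec-path (E , e) (f , p) (g , q) (k , kp) = homotopy-ind f Q at-refl g k q kp
      where
      Q : (g : (z : C) → E z) → ((z : C) → f z ≡ g z) → Set
      Q g k = (q : (x : A) (u : B x → C) → g (supC (x , u)) ≡ e x u (λ y → g (u y)))
            → ((x : A) (u : B x → C)
                 → k (supC (x , u)) ≡ proj₂ (PathFibAlg (E , e) (f , p) (g , q)) x u (λ y → k (u y)))
            → _≡_ {A = AlgSec A B C supC (E , e)} (f , p) (g , q)
      -- At the trivial homotopy the coherence kp reads refl ≡ trans (p x u) (sym (q x u)).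
      at-refl : Q f (λ _ → refl)
      at-refl q kp = cong (f ,_) (fe λ x → fe λ u →
        ≡-from-refl≡trans-sym (p x u) (q x u)
          (trans (kp x u) (cong (λ r → trans (p x u) (trans (cong (e x u) r) (sym (q x u))))
                                (funext-refl (λ y → f (u y))))))

    isind⇒AlgSec-isContr : isind A B C supC → (E : FibAlg A B C supC)
                         → isContr (AlgSec A B C supC E)
    isind⇒AlgSec-isContr ind E =
      ind E , λ t → AlgSec-path E (ind E) t (ind (PathFibAlg E (ind E) t))

corollary5p5 : FunExt → (A : Set) (B : A → Set) (C : Set) (supC : P A B C → C)
    → isProp (isind A B C supC)
corollary5p5 fe A B C supC =
  inhabited⇒isContr⇒isProp λ ind → Π-isContr fe (isind⇒AlgSec-isContr fe ind)
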